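{- For every regular tree language $L$ of $\Sigma$-trees, the binary tree $T(L)=\bigcup_{t\in L}\operatorname{dom}(t)\subseteq\{0,1\}^\star$ is regular, i.e., it is a regular language of words over $\{0,1\}$.
   Context: A tree domain is a finite prefix-closed subset $D\subseteq\{0,1\}^\star$; a $\Sigma$-tree ($\Sigma$ a finite alphabet) is a map $t\colon D\to\Sigma$ with $D=\operatorname{dom}(t)$ a tree domain. A tree language is regular if it is recognised by a deterministic bottom-up tree automaton $(Q,\iota,\delta,F)$, $\delta\colon\Sigma\times Q\times Q\to Q$, which assigns to each node $u\in\operatorname{dom}(t)$ the state $\delta(t(u),q_{u0},q_{u1})$ (where $q_v=\iota$ for $v\notin\operatorname{dom}(t)$ at the boundary) and accepts if the root state is in $F$. -}

module Defs where

open import Data.Nat using (ℕ)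
open import Data.Fin using (Fin)
open import Data.Bool using (Bool; true; false)
open import Data.List using (List; []; _∷_)
open import Data.Product using (Σ; ∃; _×_)
open import Data.Empty using (⊥)
open import Data.Unit using (⊤)
open import Relation.Binary.PropositionalEquality using (_≡_)
open import Function.Bundles using (_⇔_)

-- Words over {0,1}: false = 0, true = 1.
Word : Set
Word = List Bool

-- Finite Σ-trees with (possibly empty) finite prefix-closed domains ⊆ {0,1}*.
-- 'empty' has empty domain; 'node a l r' has root label a, and its
-- subtrees at 0 and 1 are l and r (empty if 0 resp. 1 is not in the domain).
data Tree (A : Set) : Set where
  empty : Tree A
  node  : A → Tree A → Tree A → Tree A

_∈dom_ : {A : Set} → Word → Tree A → Set
w           ∈dom empty        = ⊥
[]          ∈dom node a l r   = ⊤
(false ∷ w) ∈dom node a l r   = w ∈dom l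
(true  ∷ w) ∈dom node a l r   = w ∈dom r

record DTA (s : ℕ) : Set where
  field
    nQ : ℕ
    ι  : Fin nQ
    δ  : Fin s → Fin nQ → Fin nQ → Fin nQ
    F  : Fin nQ → Bool

-- state at the root (ι outside the domain)
runT : {s : ℕ} → (A : DTA s) → Tree (Fin s) → Fin (DTA.nQ A)
runT A empty = DTA.ι A
runT A (node a l r) = DTA.δ A a (runT A l) (runT A r)

TAccepts : {s : ℕ} → DTA s → Tree (Fin s) → Set
TAccepts A t = DTA.F A (runT A t) ≡ true

TreeLang : ℕ → Set₁
TreeLang s = Tree (Fin s) → Set

RegularTreeLang : {s : ℕ} → TreeLang s → Set
RegularTreeLang {s} L = Σ (DTA s) λ A → (t : Tree (Fin s)) → L t ⇔ TAccepts A t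

record DFA : Set where
  field
    nQ : ℕ
    q₀ : Fin nQ
    δ  : Fin nQ → Bool → Fin nQ
    F  : Fin nQ → Bool

runW : (B : DFA) → Fin (DFA.nQ B) → Word → Fin (DFA.nQ B)
runW B q []       = q
runW B q (c ∷ w)  = runW B (DFA.δ B q c) w

WAccepts : DFA → Word → Set
WAccepts B w = DFA.F B (runW B (DFA.q₀ B) w) ≡ true

WordLang : Set₁
WordLang = Word → Set

RegularWordLang : WordLang → Set
RegularWordLang K = Σ DFA λ B → (w : Word) → K w ⇔ WAccepts B w

TL : {s : ℕ} → TreeLang s → WordLang
TL {s} L w = ∃ λ (t : Tree (Fin s)) → L t × w ∈dom t

module Submission where

-- Let A be a bottom-up tree automaton for L with state set Q.  Call a set S ⊆ Q
-- *realised* at a word w if w ∈ dom(t) for some tree t whose root state lies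
-- in S; then T(L) is exactly the set of words at which the accepting states F
-- are realised.  Realisation can be tracked letter by letter: S is realised at
-- c·w iff the set of states q such that δ(a, q, r) ∈ S (q in direction c) for
-- some letter a and some *reachable* state r is realised at w, and S is
-- realised at the empty word iff S contains the state of a non-empty tree.
-- This gives a deterministic automaton whose states are subsets of Q, started
-- in F.  Two general facts make it a finite DFA:
--   * the reachable states are computable, as the saturation of an
--     inflationary operator on subsets of a finite set (Saturation), and
--   * an automaton whose state type is a retract of Fin N is equivalent to a
--     DFA with N states (toDFA); subsets of Fin n form a retract of Fin (2 ^ n).

open import Defs
open import Data.Nat using (ℕ; zero; suc; _+_; _^_; _≤_)
open import Data.Nat.Properties using (≤-refl; ≤-trans; ≤-reflexive; +-suc; +-monoʳ-≤; m≤m+n; ≤⇒≯)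
open import Data.Nat.GeneralisedArithmetic using (iterate)
open import Data.Bool using (Bool; true; false)
open import Data.Fin using (Fin; zero; suc; combine; remQuot)
open import Data.Fin.Properties using (_≟_; any?; remQuot-combine)
open import Data.Fin.Subset using (Subset; _∈_; _⊆_; _⊂_; _∪_; ∣_∣) renaming (⊥ to ∅)
open import Data.Fin.Subset.Properties using (_∈?_; _⊂?_; ⊆-antisym; p⊂q⇒∣p∣<∣q∣; ∣p∣≤n; p⊆p∪q; x∈p∪q⁺; x∈p∪q⁻; ∉⊥)
open import Data.List using ([]; _∷_)
open import Data.Vec using ([]; _∷_; tabulate)
open import Data.Vec.Properties using (lookup∘tabulate; []=⇒lookup; lookup⇒[]=)
open import Data.Product using (∃; _×_; _,_; uncurry)
open import Data.Sum using (_⊎_; inj₁; inj₂)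
open import Data.Unit using (tt)
open import Relation.Unary using (Pred; Decidable)
open import Relation.Nullary using (Dec; yes; no; does; contradiction; _×-dec_; _⊎-dec_)
open import Relation.Binary.PropositionalEquality using (_≡_; refl; sym; trans; cong; cong₂; subst; module ≡-Reasoning)
open import Function.Bundles using (_⇔_; mk⇔; Equivalence)
import Function.Properties.Equivalence as ⇔

does⇔ : ∀ {a} {A : Set a} (a? : Dec A) → does a? ≡ true ⇔ A
does⇔ (yes a) = mk⇔ (λ _ → a) (λ _ → refl)
does⇔ (no ¬a) = mk⇔ (λ ()) (λ a → contradiction a ¬a)

∈-tabulate : ∀ {n} (g : Fin n → Bool) {x : Fin n} → x ∈ tabulate g ⇔ g x ≡ true
∈-tabulate g {x} = mk⇔
  (λ x∈ → trans (sym (lookup∘tabulate g x)) ([]=⇒lookup x∈))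
  (λ gx → lookup⇒[]= x (tabulate g) (trans (lookup∘tabulate g x) gx))

⟦_⟧ : ∀ {n p} {P : Pred (Fin n) p} → Decidable P → Subset n
⟦ P? ⟧ = tabulate (λ x → does (P? x))

∈⟦⟧ : ∀ {n p} {P : Pred (Fin n) p} (P? : Decidable P) {x : Fin n} → x ∈ ⟦ P? ⟧ ⇔ P x
∈⟦⟧ P? {x} = ⇔.trans (∈-tabulate _) (does⇔ (P? x))

-- Saturation: iterating an inflationary operator f on subsets of Fin n
-- reaches a closed set (f R ⊆ R) within n + 1 rounds, since every round
-- that does not close the set adds an element.
module Saturation {n : ℕ} (f : Subset n → Subset n) (inflationary : ∀ R → R ⊆ f R) where

  Closed : Subset n → Set
  Closed R = f R ⊆ R

  grows-or-closed : ∀ R → R ⊂ f R ⊎ Closed R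
  grows-or-closed R with R ⊂? f R
  ... | yes R⊂fR = inj₁ R⊂fR
  ... | no  R⊄fR = inj₂ closed
    where
    closed : f R ⊆ R
    closed {x} x∈fR with x ∈? R
    ... | yes x∈R = x∈R
    ... | no  x∉R = contradiction ((λ {y} → inflationary R {y}) , x , x∈fR , x∉R) R⊄fR

  iterate-closed : ∀ {R} → Closed R → ∀ k → iterate f R k ≡ R
  iterate-closed c zero = refl
  iterate-closed {R} c (suc k) =
    trans (cong (λ S → iterate f S k) (⊆-antisym c (inflationary R))) (iterate-closed c k)

  grows-or-stabilises : ∀ k R → k + ∣ R ∣ ≤ ∣ iterate f R k ∣ ⊎ Closed (iterate f R k)
  grows-or-stabilises zero R = inj₁ ≤-refl
  grows-or-stabilises (suc k) R with grows-or-closed R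
  ... | inj₂ c = inj₂ (subst Closed (sym (iterate-closed c (suc k))) c)
  ... | inj₁ R⊂fR with grows-or-stabilises k (f R)
  ...   | inj₂ c     = inj₂ c
  ...   | inj₁ bound = inj₁ (≤-trans one-more bound)
    where
    one-more : suc k + ∣ R ∣ ≤ k + ∣ f R ∣
    one-more = ≤-trans (≤-reflexive (sym (+-suc k ∣ R ∣))) (+-monoʳ-≤ k (p⊂q⇒∣p∣<∣q∣ R⊂fR))

  saturate : Subset n → Subset n
  saturate R = iterate f R (suc n)

  -- n + 1 rounds cannot all add an element, so the saturation is closed.
  saturate-closed : ∀ R → Closed (saturate R)
  saturate-closed R with grows-or-stabilises (suc n) R
  ... | inj₂ c     = c
  ... | inj₁ bound =
    contradiction (≤-trans (m≤m+n (suc n) ∣ R ∣) bound) (≤⇒≯ (∣p∣≤n (saturate R)))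

  saturate-preserves : (P : Subset n → Set) → (∀ R → P R → P (f R)) →
                       ∀ R → P R → P (saturate R)
  saturate-preserves P f-preserves = go (suc n)
    where
    go : ∀ k R → P R → P (iterate f R k)
    go zero    R pR = pR
    go (suc k) R pR = go k (f R) (f-preserves R pR)

record Automaton (S : Set) : Set where
  field
    start     : S
    next      : S → Bool → S
    accepting : S → Bool

  run : S → Word → S
  run q []      = q
  run q (c ∷ w) = run (next q c) w

  Accepts : Word → Set
  Accepts w = accepting (run start w) ≡ true

record FinRetract (S : Set) (N : ℕ) : Set where
  field
    encode        : S → Fin N
    decode        : Fin N → S
    decode-encode : ∀ x → decode (encode x) ≡ x

module _ {S : Set} {N : ℕ} (ρ : FinRetract S N) (M : Automaton S) where
  open FinRetract ρ
  open Automaton M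

  toDFA : DFA
  toDFA = record
    { nQ = N
    ; q₀ = encode start
    ; δ  = λ k c → encode (next (decode k) c)
    ; F  = λ k → accepting (decode k)
    }

  toDFA-run : ∀ q w → runW toDFA (encode q) w ≡ encode (run q w)
  toDFA-run q []      = refl
  toDFA-run q (c ∷ w) rewrite decode-encode q = toDFA-run (next q c) w

  toDFA-accepts : ∀ w → WAccepts toDFA w ⇔ Accepts w
  toDFA-accepts w = mk⇔ (trans (sym same-verdict)) (trans same-verdict)
    where
    same-verdict : DFA.F toDFA (runW toDFA (encode start) w) ≡ accepting (run start w)
    same-verdict = trans (cong (λ k → accepting (decode k)) (toDFA-run start w))
                         (cong accepting (decode-encode (run start w)))

module SubsetCode where

  fromBool : Bool → Fin 2
  fromBool false = zero
  fromBool true  = suc zero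

  toBool : Fin 2 → Bool
  toBool zero    = false
  toBool (suc _) = true

  toBool-fromBool : ∀ b → toBool (fromBool b) ≡ b
  toBool-fromBool false = refl
  toBool-fromBool true  = refl

  encode : ∀ {n} → Subset n → Fin (2 ^ n)
  encode []      = zero
  encode (b ∷ p) = combine (fromBool b) (encode p)

  decode : ∀ {n} → Fin (2 ^ n) → Subset n
  decode {zero}  _ = []
  decode {suc n} k = uncurry (λ i j → toBool i ∷ decode j) (remQuot {2} (2 ^ n) k)

  decode-encode : ∀ {n} (p : Subset n) → decode (encode p) ≡ p
  decode-encode []      = refl
  decode-encode (b ∷ p) = begin
    decode (encode (b ∷ p))             ≡⟨ cong (uncurry (λ i j → toBool i ∷ decode j))
                                                 (remQuot-combine (fromBool b) (encode p)) ⟩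
    toBool (fromBool b) ∷ decode (encode p) ≡⟨ cong₂ _∷_ (toBool-fromBool b) (decode-encode p) ⟩
    b ∷ p                               ∎
    where open ≡-Reasoning

subsetRetract : ∀ n → FinRetract (Subset n) (2 ^ n)
subsetRetract n = record { SubsetCode }

module DomainAutomaton {s : ℕ} (A : DTA s) where
  open DTA A

  Reachable : Fin nQ → Set
  Reachable q = ∃ λ t → runT A t ≡ q

  Produced : Subset nQ → Fin nQ → Set
  Produced R q = ∃ λ a → ∃ λ p → ∃ λ r → p ∈ R × r ∈ R × δ a p r ≡ q

  produced? : ∀ R → Decidable (Produced R)
  produced? R q = any? λ a → any? λ p → any? λ r →
    (p ∈? R) ×-dec ((r ∈? R) ×-dec (δ a p r ≟ q))

  Derivable : Subset nQ → Fin nQ → Set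
  Derivable R q = q ≡ ι ⊎ Produced R q

  derivable? : ∀ R → Decidable (Derivable R)
  derivable? R q = (q ≟ ι) ⊎-dec produced? R q

  grow : Subset nQ → Subset nQ
  grow R = R ∪ ⟦ derivable? R ⟧

  open Saturation grow (λ R → p⊆p∪q _)

  reachableSet : Subset nQ
  reachableSet = saturate ∅

  reachable-sound : ∀ {q} → q ∈ reachableSet → Reachable q
  reachable-sound = saturate-preserves AllReachable grow-sound ∅ (λ q∈∅ → contradiction q∈∅ ∉⊥)
    where
    AllReachable : Subset nQ → Set
    AllReachable R = ∀ {q} → q ∈ R → Reachable q

    grow-sound : ∀ R → AllReachable R → AllReachable (grow R)
    grow-sound R sound q∈ with x∈p∪q⁻ R _ q∈
    ... | inj₁ q∈R = sound q∈R
    ... | inj₂ q∈new with Equivalence.to (∈⟦⟧ (derivable? R)) q∈new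
    ...   | inj₁ refl = empty , refl
    ...   | inj₂ (a , p , r , p∈R , r∈R , refl) with sound p∈R | sound r∈R
    ...     | tp , refl | tr , refl = node a tp tr , refl

  derivable-closed : ∀ {q} → Derivable reachableSet q → q ∈ reachableSet
  derivable-closed d =
    saturate-closed ∅ (x∈p∪q⁺ (inj₂ (Equivalence.from (∈⟦⟧ (derivable? reachableSet)) d)))

  reachable-complete : ∀ t → runT A t ∈ reachableSet
  reachable-complete empty        = derivable-closed (inj₁ refl)
  reachable-complete (node a l r) =
    derivable-closed (inj₂ (a , runT A l , runT A r , reachable-complete l , reachable-complete r , refl))

  Realised : Subset nQ → Word → Set
  Realised S w = ∃ λ t → runT A t ∈ S × w ∈dom t

  δ[_] : Bool → Fin s → Fin nQ → Fin nQ → Fin nQ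
  δ[ false ] a q r = δ a q r
  δ[ true  ] a q r = δ a r q

  ChildState : Subset nQ → Bool → Fin nQ → Set
  ChildState S c q = ∃ λ a → ∃ λ r → r ∈ reachableSet × δ[ c ] a q r ∈ S

  childState? : ∀ S c → Decidable (ChildState S c)
  childState? S c q = any? λ a → any? λ r → (r ∈? reachableSet) ×-dec (δ[ c ] a q r ∈? S)

  RootState : Subset nQ → Set
  RootState S = ∃ λ q → q ∈ S × Produced reachableSet q

  rootState? : ∀ S → Dec (RootState S)
  rootState? S = any? λ q → (q ∈? S) ×-dec produced? reachableSet q

  finalStates : Subset nQ
  finalStates = tabulate F

  subsetAutomaton : Automaton (Subset nQ)
  subsetAutomaton = record
    { start     = finalStates
    ; next      = λ S c → ⟦ childState? S c ⟧
    ; accepting = λ S → does (rootState? S)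
    }

  open Automaton subsetAutomaton using (run; accepting)

  ascend : ∀ S c w → Realised ⟦ childState? S c ⟧ w → Realised S (c ∷ w)
  ascend S c w (t , t∈ , w∈t) with Equivalence.to (∈⟦⟧ (childState? S c)) t∈
  ... | a , r , r∈ , parent∈S with reachable-sound r∈ | c
  ...   | tr , refl | false = node a t tr , parent∈S , w∈t
  ...   | tr , refl | true  = node a tr t , parent∈S , w∈t

  descend : ∀ S c w → Realised S (c ∷ w) → Realised ⟦ childState? S c ⟧ w
  descend S false w (node a l r , t∈S , w∈t) =
    l , Equivalence.from (∈⟦⟧ (childState? S false)) (a , runT A r , reachable-complete r , t∈S) , w∈t
  descend S true  w (node a l r , t∈S , w∈t) =
    r , Equivalence.from (∈⟦⟧ (childState? S true)) (a , runT A l , reachable-complete l , t∈S) , w∈t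

  realised-end : ∀ S → RootState S ⇔ Realised S []
  realised-end S = mk⇔ to from
    where
    to : RootState S → Realised S []
    to (q , q∈S , a , p , r , p∈ , r∈ , refl) with reachable-sound p∈ | reachable-sound r∈
    ... | tp , refl | tr , refl = node a tp tr , q∈S , tt

    from : Realised S [] → RootState S
    from (node a l r , t∈S , _) =
      _ , t∈S , a , runT A l , runT A r , reachable-complete l , reachable-complete r , refl

  accepts-from : ∀ S w → accepting (run S w) ≡ true ⇔ Realised S w
  accepts-from S []      = ⇔.trans (does⇔ (rootState? S)) (realised-end S)
  accepts-from S (c ∷ w) =
    ⇔.trans (accepts-from ⟦ childState? S c ⟧ w) (mk⇔ (ascend S c w) (descend S c w))

  TL⇔Realised : (L : TreeLang s) → (∀ t → L t ⇔ TAccepts A t) →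
                ∀ w → TL L w ⇔ Realised finalStates w
  TL⇔Realised L L⇔A w = mk⇔
    (λ (t , t∈L , w∈t) → t , Equivalence.from (∈-tabulate F) (Equivalence.to (L⇔A t) t∈L) , w∈t)
    (λ (t , t∈F , w∈t) → t , Equivalence.from (L⇔A t) (Equivalence.to (∈-tabulate F) t∈F) , w∈t)

lemma35 : (s : ℕ) (L : TreeLang s) → RegularTreeLang L → RegularWordLang (TL L)
lemma35 s L (A , L⇔A) = toDFA (subsetRetract nQ) subsetAutomaton , λ w →
  ⇔.trans (TL⇔Realised L L⇔A w)
    (⇔.trans (⇔.sym (accepts-from finalStates w))
             (⇔.sym (toDFA-accepts (subsetRetract nQ) subsetAutomaton w)))
  where
  open DTA A using (nQ)
  open DomainAutomaton A
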